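{- Let $S \subset \mathbb{R}^d$ be a finite set of points with $|S| \geq 2^{2^{d-1}}+1$. Then there exist three distinct points $x,y,z \in S$ such that $z \in R_{x,y}$. Furthermore, there exists a set $S\subset\mathbb{R}^d$ of size $|S| = 2^{2^{d-1}}$ such that there are no three distinct points $x,y,z \in S$ with $z \in R_{x,y}$.
   Context: For $x,y \in \mathbb{R}^d$, $R_{x,y} = \{ z \in \mathbb{R}^d : \min(x_i, y_i) \leq z_i \leq \max(x_i, y_i) \text{ for all } i \in [d]\}$. -}

module Defs where

open import Level using (0ℓ)
open import Data.Nat using (ℕ; _^_; _∸_)
open import Data.Fin using (Fin)
open import Data.Product using (_×_; ∃)
open import Relation.Binary.Bundles using (TotalOrder)
open import Relation.Binary.PropositionalEquality using (_≡_; _≢_)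
import Algebra.Construct.NaturalChoice.Min as Min
import Algebra.Construct.NaturalChoice.Max as Max

Point : Set → ℕ → Set
Point A d = Fin d → A

module _ (O : TotalOrder 0ℓ 0ℓ 0ℓ) where
  open TotalOrder O renaming (Carrier to A)
  open Min O using (_⊓_)
  open Max O using (_⊔_)

  InBox : {d : ℕ} → Point A d → Point A d → Point A d → Set
  InBox x y z = ∀ i → ((x i ⊓ y i) ≤ z i) × (z i ≤ (x i ⊔ y i))

  DistinctPts : {n d : ℕ} → (Fin n → Point A d) → Set
  DistinctPts p = ∀ i j → (∀ k → p i k ≈ p j k) → i ≡ j

  HasBoxTriple : {n d : ℕ} → (Fin n → Point A d) → Set
  HasBoxTriple p = ∃ λ i → ∃ λ j → ∃ λ k → (i ≢ j) × (i ≢ k) × (j ≢ k) × InBox (p i) (p j) (p k)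

bound : ℕ → ℕ
bound d = 2 ^ (2 ^ (d ∸ 1))

open import Data.Rational.Properties using (≤-decTotalOrder)
ℚ-totalOrder : TotalOrder 0ℓ 0ℓ 0ℓ
ℚ-totalOrder = DecTotalOrder.totalOrder ≤-decTotalOrder
  where open import Relation.Binary.Bundles using (DecTotalOrder)

{-# OPTIONS --safe #-}
-- Orient every pair of indices by the first coordinate, which gives a
-- tournament, and colour the edge i ⇒ j by the pattern of comparisons of p i and p j in the
-- other d − 1 coordinates.  There are 2 ^ (2 ^ (d − 1)) possible sets of colours entering a
-- vertex, so two vertices a ⇒ b have the same set.  The colour of a ⇒ b then also enters a,
-- along some i ⇒ a, and p a is coordinatewise between p i and p b.
--
-- Index the points by bit strings u of length 2 ^ (d − 1); the first coordinate
-- reads u in binary and coordinate t + 1 reads u in binary after flipping the bits at the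
-- positions whose t-th binary digit is 1.  If w lies between u and v in the first coordinate,
-- the first positions where u, w and where w, v differ are distinct, and a coordinate flipping
-- exactly one of them puts w strictly above or strictly below both u and v.

module Submission where

open import Level using (Level; 0ℓ)
open import Data.Nat as ℕ using (ℕ; zero; suc; _^_; z<s; s<s)
import Data.Nat.Properties as ℕ
open import Data.Integer.Base using (+_) renaming (_≤_ to _≤ℤ_)
import Data.Integer.Properties as ℤ
open import Data.Rational.Base as ℚ using (ℚ; ↥_)
import Data.Rational.Properties as ℚ
open import Data.Rational.Literals using (fromℤ)
open import Data.Fin.Base using (Fin; suc; toℕ; combine; funToFin; finToFun; _<_)
open import Data.Fin.Properties
  using ( <-cmp; _<?_; <-asym; <⇒≢; any?; pigeonhole; ¬∀⟶∃¬; toℕ-injective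
        ; toℕ-combine; combine-monoˡ-<; funToFin-finToFin; finToFun-funToFin )
  renaming (_≟_ to _≟ᶠ_)
open import Data.Fin.Patterns using (0F; 1F)
open import Data.Product.Base as Product using (∃; ∃₂; Σ; _,_; _×_; swap)
open import Data.Sum.Base as Sum using (_⊎_; inj₁; inj₂)
open import Data.Empty using (⊥; ⊥-elim)
open import Function.Base using (_∘_; id)
open import Relation.Binary.Core using (Rel)
open import Relation.Binary.Bundles using (TotalOrder)
open import Relation.Binary.Definitions using (Total; Decidable; Asymmetric; tri<; tri≈; tri>)
open import Relation.Binary.PropositionalEquality
open import Relation.Nullary.Decidable using (Dec; yes; no; _×-dec_; _⊎-dec_)
open import Relation.Nullary.Negation using (¬_)
import Algebra.Construct.NaturalChoice.Min as Min
import Algebra.Construct.NaturalChoice.Max as Max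
open import Defs

private variable
  a : Level
  A B : Set a
  P Q : Set a
  k m : ℕ

funToFin-cong : {u v : Fin m → Fin k} → u ≗ v → funToFin u ≡ funToFin v
funToFin-cong {zero}  _   = refl
funToFin-cong {suc m} u≗v = cong₂ combine (u≗v 0F) (funToFin-cong (u≗v ∘ suc))

funToFin-injective : {u v : Fin m → Fin k} → funToFin u ≡ funToFin v → u ≗ v
funToFin-injective {u = u} {v} eq i = begin
  u i                        ≡⟨ finToFun-funToFin u i ⟨
  finToFun (funToFin u) i    ≡⟨ cong (λ x → finToFun x i) eq ⟩
  finToFun (funToFin v) i    ≡⟨ finToFun-funToFin v i ⟩
  v i                        ∎
  where open ≡-Reasoning

finToFun-injective : {x y : Fin (k ^ m)} → finToFun {k} {m} x ≗ finToFun y → x ≡ y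
finToFun-injective {k} {m} {x} {y} eq = begin
  x                                  ≡⟨ funToFin-finToFin {m} {k} x ⟨
  funToFin (finToFun {k} {m} x)      ≡⟨ funToFin-cong eq ⟩
  funToFin (finToFun {k} {m} y)      ≡⟨ funToFin-finToFin {m} {k} y ⟩
  y                                  ∎
  where open ≡-Reasoning

tag : A ⊎ B → Fin 2
tag (inj₁ _) = 0F
tag (inj₂ _) = 1F

indicator : Dec P → Fin 2
indicator (yes _) = 1F
indicator (no _)  = 0F

indicator-reflects : (P? : Dec P) (Q? : Dec Q) → indicator P? ≡ indicator Q? → P → Q
indicator-reflects _       (yes q) _  _ = q
indicator-reflects (no ¬p) (no _)  _  p = ⊥-elim (¬p p)
indicator-reflects (yes _) (no _)  ()

IsInj₁ IsInj₂ : A ⊎ B → Set _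
IsInj₁ s = ∃ λ x → s ≡ inj₁ x
IsInj₂ s = ∃ λ y → s ≡ inj₂ y

isInj₁? : (s : A ⊎ B) → Dec (IsInj₁ s)
isInj₁? (inj₁ x) = yes (x , refl)
isInj₁? (inj₂ _) = no λ ()

isInj₂? : (s : A ⊎ B) → Dec (IsInj₂ s)
isInj₂? (inj₁ _) = no λ ()
isInj₂? (inj₂ y) = yes (y , refl)

isInj₁⊎isInj₂ : (s : A ⊎ B) → IsInj₁ s ⊎ IsInj₂ s
isInj₁⊎isInj₂ (inj₁ x) = inj₁ (x , refl)
isInj₁⊎isInj₂ (inj₂ y) = inj₂ (y , refl)

¬isInj₁×isInj₂ : {s : A ⊎ B} → IsInj₁ s → ¬ IsInj₂ s
¬isInj₁×isInj₂ (_ , refl) (_ , ())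

record IsTournament {n ℓ} (_⇒_ : Rel (Fin n) ℓ) : Set ℓ where
  field
    _⇒?_   : Decidable _⇒_
    asym   : Asymmetric _⇒_
    connex : ∀ {i j} → i ≢ j → i ⇒ j ⊎ j ⇒ i

  path-distinct : ∀ {i j k} → i ⇒ j → j ⇒ k → i ≢ j × i ≢ k × j ≢ k
  path-distinct i⇒j j⇒k = (λ { refl → asym i⇒j i⇒j })
                        , (λ { refl → asym i⇒j j⇒k })
                        , (λ { refl → asym j⇒k j⇒k })

-- An edge between i < j points the way `total` chose; this need not be transitive.
module Orientation {n ℓ} {R : Rel (Fin n) ℓ} (total : Total R) where

  _⇒_ : Rel (Fin n) ℓ
  i ⇒ j = i < j × IsInj₁ (total i j) ⊎ j < i × IsInj₂ (total j i)

  ⇒-sound : ∀ {i j} → i ⇒ j → R i j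
  ⇒-sound (inj₁ (_ , r , _)) = r
  ⇒-sound (inj₂ (_ , r , _)) = r

  isTournament : IsTournament _⇒_
  isTournament = record { _⇒?_ = _⇒?_ ; asym = asym ; connex = connex }
    where
      _⇒?_ : Decidable _⇒_
      i ⇒? j = (i <? j ×-dec isInj₁? (total i j)) ⊎-dec (j <? i ×-dec isInj₂? (total j i))

      asym : Asymmetric _⇒_
      asym (inj₁ (i<j , _))  (inj₁ (j<i , _))  = <-asym i<j j<i
      asym (inj₁ (_ , left)) (inj₂ (_ , right)) = ¬isInj₁×isInj₂ left right
      asym (inj₂ (_ , right)) (inj₁ (_ , left)) = ¬isInj₁×isInj₂ left right
      asym (inj₂ (j<i , _))  (inj₂ (i<j , _))  = <-asym j<i i<j

      orient : ∀ {i j} → i < j → i ⇒ j ⊎ j ⇒ i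
      orient i<j = Sum.map (λ left → inj₁ (i<j , left)) (λ right → inj₂ (i<j , right))
                           (isInj₁⊎isInj₂ (total _ _))

      connex : ∀ {i j} → i ≢ j → i ⇒ j ⊎ j ⇒ i
      connex {i} {j} i≢j with <-cmp i j
      ... | tri< i<j _ _ = orient i<j
      ... | tri≈ _ i≡j _ = ⊥-elim (i≢j i≡j)
      ... | tri> _ _ j<i = Sum.swap (orient j<i)

module _ {n ℓ K} {_⇒_ : Rel (Fin n) ℓ} (T : IsTournament _⇒_) (colour : Fin n → Fin n → Fin K) where
  open IsTournament T

  inColour? : ∀ j c → Dec (∃ λ i → i ⇒ j × colour i j ≡ c)
  inColour? j c = any? λ i → (i ⇒? j) ×-dec (colour i j ≟ᶠ c)

  MonochromaticPath : Set ℓ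
  MonochromaticPath = ∃₂ λ i j → ∃ λ k → i ⇒ j × j ⇒ k × colour i j ≡ colour j k

  inColours : Fin n → Fin K → Fin 2
  inColours j c = indicator (inColour? j c)

  path-into-edge : ∀ {j k} → j ⇒ k → inColours k ≗ inColours j → MonochromaticPath
  path-into-edge {j} {k} j⇒k same
    with i , i⇒j , colour-eq ← indicator-reflects _ _ (same (colour j k)) (j , j⇒k , refl)
    = i , j , k , i⇒j , j⇒k , colour-eq

  monochromatic-path : 2 ^ K ℕ.< n → MonochromaticPath
  monochromatic-path 2^K<n with a , b , a<b , same ← pigeonhole 2^K<n (funToFin ∘ inColours)
    with connex (<⇒≢ a<b)
  ... | inj₁ a⇒b = path-into-edge a⇒b (sym ∘ funToFin-injective same)
  ... | inj₂ b⇒a = path-into-edge b⇒a (funToFin-injective same)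

module _ {a ℓ₁ ℓ₂} (O : TotalOrder a ℓ₁ ℓ₂) where
  open TotalOrder O using (_≤_; ≤-respˡ-≈; ≤-respʳ-≈) renaming (Carrier to X)
  open Min O using (_⊓_; ⊓-sel; x≤y⇒x⊓z≤y; x≤y⇒z⊓x≤y)
  open Max O using (_⊔_; ⊔-sel; x≤y⇒x≤y⊔z; x≤y⇒x≤z⊔y)

  Between : X → X → X → Set ℓ₂
  Between x y z = x ⊓ y ≤ z × z ≤ x ⊔ y

  between-by-tags : ∀ {x y z} (s : x ≤ z ⊎ z ≤ x) (s′ : z ≤ y ⊎ y ≤ z) → tag s ≡ tag s′ → Between x y z
  between-by-tags (inj₁ x≤z) (inj₁ z≤y) _ = x≤y⇒x⊓z≤y _ x≤z , x≤y⇒x≤z⊔y _ z≤y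
  between-by-tags (inj₂ z≤x) (inj₂ y≤z) _ = x≤y⇒z⊓x≤y _ y≤z , x≤y⇒x≤y⊔z _ z≤x

  ⊓≤-sel : ∀ {x y z} → x ⊓ y ≤ z → x ≤ z ⊎ y ≤ z
  ⊓≤-sel {x} {y} x⊓y≤z = Sum.map (λ eq → ≤-respˡ-≈ eq x⊓y≤z) (λ eq → ≤-respˡ-≈ eq x⊓y≤z) (⊓-sel x y)

  ≤⊔-sel : ∀ {x y z} → z ≤ x ⊔ y → z ≤ x ⊎ z ≤ y
  ≤⊔-sel {x} {y} z≤x⊔y = Sum.map (λ eq → ≤-respʳ-≈ eq z≤x⊔y) (λ eq → ≤-respʳ-≈ eq z≤x⊔y) (⊔-sel x y)

module BoxTriple (O : TotalOrder 0ℓ 0ℓ 0ℓ) {n d : ℕ} (p : Fin n → Point (TotalOrder.Carrier O) (suc d)) where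
  open TotalOrder O using (total)
  open Orientation (λ i j → total (p i 0F) (p j 0F))

  signs : Fin n → Fin n → Fin d → Fin 2
  signs i j t = tag (total (p i (suc t)) (p j (suc t)))

  inBox-along-path : ∀ {i j k} → i ⇒ j → j ⇒ k → signs i j ≗ signs j k → InBox O (p i) (p k) (p j)
  inBox-along-path i⇒j j⇒k _    0F      = between-by-tags O (inj₁ (⇒-sound i⇒j)) (inj₁ (⇒-sound j⇒k)) refl
  inBox-along-path _   _   same (suc t) = between-by-tags O _ _ (same t)

  boxTriple : bound (suc d) ℕ.< n → HasBoxTriple O p
  boxTriple bound<n
    with i , j , k , i⇒j , j⇒k , same ← monochromatic-path isTournament (λ i j → funToFin (signs i j)) bound<n
    with i≢j , i≢k , j≢k ← IsTournament.path-distinct isTournament i⇒j j⇒k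
    = i , k , j , i≢k , i≢j , j≢k ∘ sym , inBox-along-path i⇒j j⇒k (funToFin-injective same)

combine-monoʳ-< : ∀ {n} (i : Fin m) {j l : Fin n} → j < l → combine i j < combine i l
combine-monoʳ-< {n = n} i {j} {l} j<l = begin-strict
  toℕ (combine i j)      ≡⟨ toℕ-combine i j ⟩
  n ℕ.* toℕ i ℕ.+ toℕ j  <⟨ ℕ.+-monoʳ-< (n ℕ.* toℕ i) j<l ⟩
  n ℕ.* toℕ i ℕ.+ toℕ l  ≡⟨ toℕ-combine i l ⟨
  toℕ (combine i l)      ∎
  where open ℕ.≤-Reasoning

infix 4 _<lex[_]_

data _<lex[_]_ : ∀ {m} → (Fin m → Fin k) → Fin m → (Fin m → Fin k) → Set where
  here  : {u v : Fin (suc m) → Fin k} → u 0F < v 0F → u <lex[ 0F ] v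
  there : {u v : Fin (suc m) → Fin k} {p : Fin m} →
          u 0F ≡ v 0F → u ∘ suc <lex[ p ] v ∘ suc → u <lex[ suc p ] v

lex-trichotomy : (u v : Fin m → Fin k) → u ≗ v ⊎ ∃ (u <lex[_] v) ⊎ ∃ (v <lex[_] u)
lex-trichotomy {zero}  u v = inj₁ λ ()
lex-trichotomy {suc m} u v with <-cmp (u 0F) (v 0F) | lex-trichotomy (u ∘ suc) (v ∘ suc)
... | tri< u₀<v₀ _ _ | _                    = inj₂ (inj₁ (0F , here u₀<v₀))
... | tri> _ _ v₀<u₀ | _                    = inj₂ (inj₂ (0F , here v₀<u₀))
... | tri≈ _ u₀≡v₀ _ | inj₁ tail≗          = inj₁ λ { 0F → u₀≡v₀ ; (suc i) → tail≗ i }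
... | tri≈ _ u₀≡v₀ _ | inj₂ (inj₁ (p , l)) = inj₂ (inj₁ (suc p , there u₀≡v₀ l))
... | tri≈ _ u₀≡v₀ _ | inj₂ (inj₂ (p , l)) = inj₂ (inj₂ (suc p , there (sym u₀≡v₀) l))

funToFin-mono-lex : {u v : Fin m → Fin k} {p : Fin m} → u <lex[ p ] v → funToFin u < funToFin v
funToFin-mono-lex (here u₀<v₀)   = combine-monoˡ-< _ _ u₀<v₀
funToFin-mono-lex {v = v} (there u₀≡v₀ l) rewrite u₀≡v₀ = combine-monoʳ-< (v 0F) (funToFin-mono-lex l)

Fin2-no-<-chain : {a b c : Fin 2} → a < b → b < c → ⊥
Fin2-no-<-chain {b = 0F} ()
Fin2-no-<-chain {b = 1F} {c = 0F} _ ()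
Fin2-no-<-chain {b = 1F} {c = 1F} _ (s<s ())

lex-chain-positions-differ : {u v w : Fin m → Fin 2} {p q : Fin m} →
                             u <lex[ p ] w → w <lex[ q ] v → p ≢ q
lex-chain-positions-differ (here u₀<w₀)  (here w₀<v₀)  refl = Fin2-no-<-chain u₀<w₀ w₀<v₀
lex-chain-positions-differ (there _ l₁) (there _ l₂) refl = lex-chain-positions-differ l₁ l₂ refl

infixl 6 _⊕_ _⊕ᵥ_

_⊕_ : Fin 2 → Fin 2 → Fin 2
0F ⊕ b  = b
1F ⊕ 0F = 1F
1F ⊕ 1F = 0F

_⊕ᵥ_ : (Fin m → Fin 2) → (Fin m → Fin 2) → Fin m → Fin 2
(M ⊕ᵥ u) i = M i ⊕ u i

⊕-monoʳ-< : {c a b : Fin 2} → c ≡ 0F → a < b → c ⊕ a < c ⊕ b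
⊕-monoʳ-< refl a<b = a<b

⊕-antimonoʳ-< : {c a b : Fin 2} → c ≡ 1F → a < b → c ⊕ b < c ⊕ a
⊕-antimonoʳ-< {a = 0F} {1F} refl _ = z<s
⊕-antimonoʳ-< {b = 0F} refl ()
⊕-antimonoʳ-< {a = 1F} {1F} refl (s<s ())

⊕-preserves-lex : {u v M : Fin m → Fin 2} {p : Fin m} →
                  u <lex[ p ] v → M p ≡ 0F → M ⊕ᵥ u <lex[ p ] M ⊕ᵥ v
⊕-preserves-lex (here u₀<v₀) M₀≡0 = here (⊕-monoʳ-< M₀≡0 u₀<v₀)
⊕-preserves-lex {M = M} (there u₀≡v₀ l) Mp≡0 =
  there (cong (M 0F ⊕_) u₀≡v₀) (⊕-preserves-lex l Mp≡0)

⊕-reverses-lex : {u v M : Fin m → Fin 2} {p : Fin m} →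
                 u <lex[ p ] v → M p ≡ 1F → M ⊕ᵥ v <lex[ p ] M ⊕ᵥ u
⊕-reverses-lex (here u₀<v₀) M₀≡1 = here (⊕-antimonoʳ-< M₀≡1 u₀<v₀)
⊕-reverses-lex {M = M} (there u₀≡v₀ l) Mp≡1 =
  there (cong (M 0F ⊕_) (sym u₀≡v₀)) (⊕-reverses-lex l Mp≡1)

Extremal : Fin k → Fin k → Fin k → Set
Extremal x y z = (x < z × y < z) ⊎ (z < x × z < y)

Extremal-swap : {x y z : Fin k} → Extremal x y z → Extremal y x z
Extremal-swap = Sum.map swap swap

module Masked {m D : ℕ} (mask : Fin D → Fin m → Fin 2)
              (c₀ : Fin D) (unmasked : ∀ q → mask c₀ q ≡ 0F)
              (separating : ∀ {p q} → p ≢ q → ∃ λ c → mask c p ≢ mask c q) where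

  code : Fin D → (Fin m → Fin 2) → Fin (2 ^ m)
  code c u = funToFin (mask c ⊕ᵥ u)

  private variable
    u v w : Fin m → Fin 2
    p q : Fin m

  code-preserves-lex : ∀ c → u <lex[ p ] w → mask c p ≡ 0F → code c u < code c w
  code-preserves-lex c u<w = funToFin-mono-lex ∘ ⊕-preserves-lex u<w

  code-reverses-lex : ∀ c → u <lex[ p ] w → mask c p ≡ 1F → code c w < code c u
  code-reverses-lex c u<w = funToFin-mono-lex ∘ ⊕-reverses-lex u<w

  chain-extremal : u <lex[ p ] w → w <lex[ q ] v → ∃ λ c → Extremal (code c u) (code c v) (code c w)
  chain-extremal {p = p} {q = q} u<w w<v with separating (lex-chain-positions-differ u<w w<v)
  ... | c , differ with mask c p in mp | mask c q in mq
  ... | 0F | 0F = ⊥-elim (differ refl)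
  ... | 1F | 1F = ⊥-elim (differ refl)
  ... | 0F | 1F = c , inj₁ (code-preserves-lex c u<w mp , code-reverses-lex c w<v mq)
  ... | 1F | 0F = c , inj₂ (code-reverses-lex c u<w mp , code-preserves-lex c w<v mq)

  extremal-coordinate : ¬ u ≗ w → ¬ w ≗ v → ∃ λ c → Extremal (code c u) (code c v) (code c w)
  extremal-coordinate {u} {w} {v} u≉w w≉v with lex-trichotomy u w | lex-trichotomy w v
  ... | inj₁ u≗w              | _                     = ⊥-elim (u≉w u≗w)
  ... | _                     | inj₁ w≗v              = ⊥-elim (w≉v w≗v)
  ... | inj₂ (inj₁ (_ , u<w)) | inj₂ (inj₁ (_ , w<v)) = chain-extremal u<w w<v
  ... | inj₂ (inj₂ (_ , w<u)) | inj₂ (inj₂ (_ , v<w)) = Product.map₂ Extremal-swap (chain-extremal v<w w<u)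
  ... | inj₂ (inj₁ (_ , u<w)) | inj₂ (inj₂ (_ , v<w)) = c₀ ,
        inj₁ (code-preserves-lex c₀ u<w (unmasked _) , code-preserves-lex c₀ v<w (unmasked _))
  ... | inj₂ (inj₂ (_ , w<u)) | inj₂ (inj₁ (_ , w<v)) = c₀ ,
        inj₂ (code-preserves-lex c₀ w<u (unmasked _) , code-preserves-lex c₀ w<v (unmasked _))

toℚ : Fin k → ℚ
toℚ i = fromℤ (+ toℕ i)

toℚ-injective : {i j : Fin k} → toℚ i ≡ toℚ j → i ≡ j
toℚ-injective eq = toℕ-injective (ℤ.+-injective (cong ↥_ eq))

toℚ-cancel-≤ : {i j : Fin k} → toℚ i ℚ.≤ toℚ j → toℕ i ℕ.≤ toℕ j
toℚ-cancel-≤ le = ℤ.drop‿+≤+ (subst₂ _≤ℤ_ (ℤ.*-identityʳ _) (ℤ.*-identityʳ _) (ℚ.drop-*≤* le))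

extremal⇒¬between : {x y z : Fin k} → Extremal x y z → ¬ Between ℚ-totalOrder (toℚ x) (toℚ y) (toℚ z)
extremal⇒¬between (inj₁ (x<z , y<z)) (_ , z≤x⊔y) =
  Sum.[ ℕ.<⇒≱ x<z ∘ toℚ-cancel-≤ , ℕ.<⇒≱ y<z ∘ toℚ-cancel-≤ ] (≤⊔-sel ℚ-totalOrder z≤x⊔y)
extremal⇒¬between (inj₂ (z<x , z<y)) (x⊓y≤z , _) =
  Sum.[ ℕ.<⇒≱ z<x ∘ toℚ-cancel-≤ , ℕ.<⇒≱ z<y ∘ toℚ-cancel-≤ ] (⊓≤-sel ℚ-totalOrder x⊓y≤z)

bitMask : (d : ℕ) → Fin (suc d) → Fin (2 ^ d) → Fin 2
bitMask d 0F      _ = 0F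
bitMask d (suc t) q = finToFun q t

bitMask-separating : ∀ {d} {p q : Fin (2 ^ d)} → p ≢ q → ∃ λ c → bitMask d c p ≢ bitMask d c q
bitMask-separating {d} {p} {q} p≢q =
  Product.map suc id (¬∀⟶∃¬ d _ (λ t → finToFun p t ≟ᶠ finToFun q t) (p≢q ∘ finToFun-injective))

module NoBoxPoints (d : ℕ) where
  open Masked (bitMask d) 0F (λ _ → refl) bitMask-separating

  points : Fin (bound (suc d)) → Point ℚ (suc d)
  points x c = toℚ (code c (finToFun x))

  points-distinct : DistinctPts ℚ-totalOrder points
  points-distinct x y same = finToFun-injective {m = 2 ^ d} (funToFin-injective (toℚ-injective (same 0F)))

  points-noBoxTriple : ¬ HasBoxTriple ℚ-totalOrder points
  points-noBoxTriple (i , j , k , _ , i≢k , j≢k , inBox)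
    with c , extremal ← extremal-coordinate (i≢k ∘ finToFun-injective) (j≢k ∘ sym ∘ finToFun-injective)
    = extremal⇒¬between extremal (inBox c)

open import Data.Nat using (_+_; _≤_)

mainTheorem7 :
    ((O : TotalOrder _ _ _) → (d : ℕ) → 1 ≤ d → (n : ℕ) → bound d + 1 ≤ n →
      (p : Fin n → Point (TotalOrder.Carrier O) d) → DistinctPts O p → HasBoxTriple O p)
    × ((d : ℕ) → 1 ≤ d →
      Σ (Fin (bound d) → Point ℚ d) λ p → DistinctPts ℚ-totalOrder p × ¬ HasBoxTriple ℚ-totalOrder p)
mainTheorem7 =
    (λ { O (suc d) _ n bound+1≤n p _ →
           BoxTriple.boxTriple O p (subst (ℕ._≤ n) (ℕ.+-comm (bound (suc d)) 1) bound+1≤n) })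
  , λ { (suc d) _ → let open NoBoxPoints d in points , points-distinct , points-noBoxTriple }
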